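{- For every $n\ge 2$, the number of permutations $\sigma\in S_n$ that contain $n$ immediately followed by $1$ (in consecutive positions) and satisfy $mmp^{(1,0,1,1)}(\sigma)=0$ equals $\frac{1+3^{n-2}}{2}$.
   Context: For $\sigma=\sigma_1\cdots\sigma_n\in S_n$, $\sigma_i$ matches $MMP(1,0,1,1)$ if there is some $j>i$ with $\sigma_j>\sigma_i$, some $j<i$ with $\sigma_j<\sigma_i$, and some $j>i$ with $\sigma_j<\sigma_i$. $mmp^{(1,0,1,1)}(\sigma)$ is the number of such $i$. -}

module Defs where

open import Data.Nat using (ℕ; zero; suc; _<ᵇ_; _≡ᵇ_)
open import Data.Nat.Properties using (_≟_)
open import Data.Bool using (Bool; true; false; _∧_; _∨_)
open import Data.List using (List; []; _∷_; _++_; [_]; map; concatMap; upTo; filter; filterᵇ; length)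
open import Data.Bool.ListAction using (any)
open import Data.List.Relation.Unary.Unique.DecPropositional _≟_ using (unique?)

-- A permutation σ ∈ S_n is represented in one-line notation as the list
-- σ₁ σ₂ … σₙ of natural numbers, a rearrangement of 1, 2, …, n.

words : ℕ → ℕ → List (List ℕ)
words zero    n = [ [] ]
words (suc k) n = concatMap (λ a → map (a ∷_) (words k n)) (map suc (upTo n))

S : ℕ → List (List ℕ)
S n = filter unique? (words n n)

nThen1 : ℕ → List ℕ → Bool
nThen1 n []           = false
nThen1 n (x ∷ [])     = false
nThen1 n (x ∷ y ∷ ys) = ((x ≡ᵇ n) ∧ (y ≡ᵇ 1)) ∨ nThen1 n (y ∷ ys)

matchesMMP : List ℕ → ℕ → List ℕ → Bool
matchesMMP pre x suf =
  any (λ y → x <ᵇ y) suf ∧ any (λ y → y <ᵇ x) pre ∧ any (λ y → y <ᵇ x) suf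

mmpAux : List ℕ → List ℕ → ℕ
mmpAux pre []       = 0
mmpAux pre (x ∷ xs) with matchesMMP pre x xs
... | true  = suc (mmpAux (pre ++ [ x ]) xs)
... | false = mmpAux (pre ++ [ x ]) xs

mmp1011 : List ℕ → ℕ
mmp1011 σ = mmpAux [] σ

count18 : ℕ → ℕ
count18 n = length (filterᵇ (λ σ → nThen1 n σ ∧ (mmp1011 σ ≡ᵇ 0)) (S n))

-- Let σ contain n immediately followed by 1 and avoid MMP(1,0,1,1). An entry before n has the
-- larger n and the smaller 1 after it, so no smaller entry may precede it: the entries before n
-- decrease. An entry after n 1 has the smaller 1 before it, so it must be the least or the
-- greatest of the entries from it onwards. Conversely every such permutation avoids the pattern.
-- The permutations are counted by building them from the left, one letter at a time; the
-- resulting recursion satisfies a Pascal-type rule, from which 2 · count = 3^(n-2) + 1.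

module Submission where

open import Defs
open import Data.Bool using (Bool; true; false; T; _∧_; if_then_else_)
open import Data.Bool.Properties using (T-∧; T-∨; ∧-identityʳ; T-≡)
open import Data.Empty using (⊥; ⊥-elim)
open import Data.List
  using (List; []; _∷_; _++_; [_]; map; concatMap; upTo; applyUpTo; filter; filterᵇ; length)
open import Data.List.Properties
  using (++-assoc; ++-identityʳ; map-upTo; length-applyUpTo; filter-accept; filter-reject; filter-all; filter-notAll)
open import Data.List.Extrema.Nat using (max; argmax-sel; ⊥≤max; xs≤max)
open import Data.List.Membership.Propositional using (_∈_; _∉_; lose; find)
open import Data.List.Membership.Propositional.Properties
  using ( ∈-++⁺ˡ; ∈-++⁺ʳ; ∈-++⁻; ∈-length; ∈-filter⁺; ∈-filter⁻; ∈-map⁻; map∷⁻; ∈-upTo⁻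
        ; ∈-applyUpTo⁺; ∈-concatMap⁻)
open import Data.List.Relation.Binary.Subset.Propositional using (_⊆_)
open import Data.List.Relation.Unary.All as All using (All; []; _∷_)
open import Data.List.Relation.Unary.All.Properties as All using (All¬⇒¬Any; anti-mono)
open import Data.List.Relation.Unary.AllPairs as AllPairs using (AllPairs; []; _∷_)
import Data.List.Relation.Unary.AllPairs.Properties as AllPairs
open import Data.List.Relation.Unary.Any as Any using (Any; here; there)
open import Data.List.Relation.Unary.Any.Properties using (any⁺; any⁻)
open import Data.List.Relation.Unary.Unique.Propositional using (Unique)
open import Data.List.Relation.Unary.Unique.Propositional.Properties as Unique using (Unique[x∷xs]⇒x∉xs)
open import Data.Nat
  using (ℕ; zero; suc; _+_; _*_; _^_; _∸_; _/_; _≤_; _<_; _≡ᵇ_; z≤n; s≤s; z<s; s<s; s<s⁻¹)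
open import Data.Nat.Properties
open import Data.List.Membership.DecPropositional _≟_ using (_∈?_)
open import Data.List.Relation.Unary.Unique.DecPropositional _≟_ using (unique?)
open import Data.Nat.DivMod using (m*n/n≡m)
open import Data.Nat.Tactic.RingSolver using (solve-∀)
open import Data.Product using (_×_; _,_; proj₁; proj₂)
import Data.Product as Product
open import Data.Sum using (_⊎_; inj₁; inj₂)
import Data.Sum as Sum
open import Function using (_∘_; id; Equivalence)
open import Relation.Binary using (DecidableEquality)
open import Relation.Binary.PropositionalEquality
  using (_≡_; _≢_; refl; sym; trans; cong; cong₂; subst; ≢-sym; module ≡-Reasoning)
open import Relation.Nullary using (¬_; yes; no; does; ¬?)
open import Relation.Nullary.Decidable using (T?; toWitness; isYes≗does)
open import Relation.Unary using (Decidable)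

open Equivalence using (to; from)
open ≡-Reasoning

-- Lists without repetition

module _ {A : Set} where

  Unique-++⁻ʳ : ∀ xs {ys : List A} → Unique (xs ++ ys) → Unique ys
  Unique-++⁻ʳ []       u       = u
  Unique-++⁻ʳ (x ∷ xs) (_ ∷ u) = Unique-++⁻ʳ xs u

  Unique-++⇒disjoint : ∀ xs {ys} {x : A} → Unique (xs ++ ys) → x ∈ xs → x ∉ ys
  Unique-++⇒disjoint (x ∷ xs) (x∉ ∷ _) (here refl)  x∈ys = All.lookup x∉ (∈-++⁺ʳ xs x∈ys) refl
  Unique-++⇒disjoint (x ∷ xs) (_ ∷ u)  (there x∈xs) = Unique-++⇒disjoint xs u x∈xs

  Unique-∷ʳ : ∀ {xs} {x : A} → Unique xs → x ∉ xs → Unique (xs ++ [ x ])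
  Unique-∷ʳ u x∉xs = Unique.++⁺ u ([] ∷ []) λ { (x∈xs , here refl) → x∉xs x∈xs }

module Removal {A : Set} (_≟ᴬ_ : DecidableEquality A) where

  open import Data.List.Membership.DecPropositional _≟ᴬ_ using () renaming (_∈?_ to _∈ᴬ?_)

  private
    ≢? : (a : A) → Decidable (_≢ a)
    ≢? a x = ¬? (x ≟ᴬ a)

  without : A → List A → List A
  without a = filter (≢? a)

  ∈-without⁺ : ∀ {a x xs} → x ∈ xs → x ≢ a → x ∈ without a xs
  ∈-without⁺ {a} = ∈-filter⁺ (≢? a)

  ∈-without⁻ : ∀ {a x} xs → x ∈ without a xs → x ∈ xs × x ≢ a
  ∈-without⁻ {a} _ = ∈-filter⁻ (≢? a)

  length-without : ∀ {a xs} → Unique xs → a ∈ xs → suc (length (without a xs)) ≡ length xs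
  length-without {a} (a∉xs ∷ _) (here refl) = cong (suc ∘ length)
    (trans (filter-reject (≢? a) λ a≢a → a≢a refl)
           (filter-all (≢? a) (All.map ≢-sym a∉xs)))
  length-without {a} (x∉xs ∷ u) (there a∈xs) = trans
    (cong (suc ∘ length) (filter-accept (≢? a) (All.lookup x∉xs a∈xs)))
    (cong suc (length-without u a∈xs))

  length-without< : ∀ {a xs} → a ∈ xs → length (without a xs) < length xs
  length-without< {a} a∈xs =
    filter-notAll (≢? a) _ (Any.map (λ a≡x x≢a → x≢a (sym a≡x)) a∈xs)

  Unique⇒length≤ : ∀ {xs ys} → Unique xs → xs ⊆ ys → length xs ≤ length ys
  Unique⇒length≤ {[]}     _          _     = z≤n
  Unique⇒length≤ {x ∷ xs} (x∉xs ∷ u) xs⊆ys = ≤-trans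
    (s≤s (Unique⇒length≤ u λ y∈xs → ∈-without⁺ (xs⊆ys (there y∈xs)) (≢-sym (All.lookup x∉xs y∈xs))))
    (length-without< (xs⊆ys (here refl)))

  pigeonhole : ∀ {xs ys} → Unique xs → xs ⊆ ys → length ys ≤ length xs → ys ⊆ xs
  pigeonhole {xs} {ys} u xs⊆ys ys≤xs {y} y∈ys with y ∈ᴬ? xs
  ... | yes y∈xs = y∈xs
  ... | no  y∉xs = ⊥-elim (≤⇒≯ ys≤xs (≤-<-trans xs≤ys∖y (length-without< y∈ys)))
    where
    xs≤ys∖y : length xs ≤ length (without y ys)
    xs≤ys∖y = Unique⇒length≤ u λ x∈xs → ∈-without⁺ (xs⊆ys x∈xs) λ x≡y → y∉xs (subst (_∈ xs) x≡y x∈xs)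

open Removal _≟_

-- Finite sums and the counting sequences

Σ< : ℕ → (ℕ → ℕ) → ℕ
Σ< zero    f = 0
Σ< (suc m) f = f 0 + Σ< m (f ∘ suc)

Σ<-cong : ∀ m {f g} → (∀ {i} → i < m → f i ≡ g i) → Σ< m f ≡ Σ< m g
Σ<-cong zero    _ = refl
Σ<-cong (suc m) f≗g = cong₂ _+_ (f≗g z<s) (Σ<-cong m (f≗g ∘ s<s))

Σ<-zero : ∀ m {f} → (∀ {i} → i < m → f i ≡ 0) → Σ< m f ≡ 0
Σ<-zero zero    _  = refl
Σ<-zero (suc m) f0 = cong₂ _+_ (f0 z<s) (Σ<-zero m (f0 ∘ s<s))

Σ<-snoc : ∀ m f → Σ< (suc m) f ≡ Σ< m f + f m
Σ<-snoc zero    f = +-identityʳ (f 0)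
Σ<-snoc (suc m) f = trans (cong (f 0 +_) (Σ<-snoc m (f ∘ suc))) (sym (+-assoc (f 0) _ _))

Σ<-truncate : ∀ {k m f} → k ≤ m → (∀ {i} → k ≤ i → i < m → f i ≡ 0) → Σ< m f ≡ Σ< k f
Σ<-truncate {m = m} z≤n f0 = Σ<-zero m (f0 z≤n)
Σ<-truncate (s≤s k≤m) f0 = cong (_ +_) (Σ<-truncate k≤m λ k≤i i<m → f0 (s≤s k≤i) (s<s i<m))

Σ<-single : ∀ {b m f} → b < m → (∀ {i} → i < m → i ≢ b → f i ≡ 0) → Σ< m f ≡ f b
Σ<-single {zero} {suc m} {f} _ f0 =
  trans (cong (f 0 +_) (Σ<-zero m λ i<m → f0 (s<s i<m) λ ())) (+-identityʳ (f 0))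
Σ<-single {suc b} (s<s b<m) f0 =
  cong₂ _+_ (f0 z<s λ ()) (Σ<-single b<m λ i<m i≢b → f0 (s<s i<m) (i≢b ∘ suc-injective))

Σ<-pair : ∀ {b b′ m f} → b < b′ → b′ < m → (∀ {i} → i < m → i ≢ b → i ≢ b′ → f i ≡ 0) →
          Σ< m f ≡ f b + f b′
Σ<-pair {zero} {suc b′} {suc m} {f} _ (s<s b′<m) f0 =
  cong (f 0 +_) (Σ<-single b′<m λ i<m i≢b′ → f0 (s<s i<m) (λ ()) (i≢b′ ∘ suc-injective))
Σ<-pair {suc b} {suc b′} (s<s b<b′) (s<s b′<m) f0 =
  cong₂ _+_ (f0 z<s (λ ()) (λ ()))
    (Σ<-pair b<b′ b′<m λ i<m i≢b i≢b′ → f0 (s<s i<m) (i≢b ∘ suc-injective) (i≢b′ ∘ suc-injective))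

InRange : ℕ → ℕ → Set
InRange n x = 1 ≤ x × x ≤ n

Σ<-suc-single : ∀ {b m} (f : ℕ → ℕ) → InRange m b → (∀ {a} → InRange m a → a ≢ b → f a ≡ 0) →
                Σ< m (f ∘ suc) ≡ f b
Σ<-suc-single f (s≤s z≤n , b<m) f0 = Σ<-single b<m λ i<m i≢b → f0 (s≤s z≤n , i<m) (i≢b ∘ suc-injective)

Σ<-suc-pair : ∀ {b b′ m} (f : ℕ → ℕ) → InRange m b → InRange m b′ → b < b′ →
              (∀ {a} → InRange m a → a ≢ b → a ≢ b′ → f a ≡ 0) → Σ< m (f ∘ suc) ≡ f b + f b′
Σ<-suc-pair f (s≤s z≤n , _) (s≤s z≤n , b′<m) b<b′ f0 = Σ<-pair (s<s⁻¹ b<b′) b′<m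
  λ i<m i≢b i≢b′ → f0 (s≤s z≤n , i<m) (i≢b ∘ suc-injective) (i≢b′ ∘ suc-injective)

Σ<-suc-top+low : ∀ {c n} (f : ℕ → ℕ) → 2 + c ≤ n → f 1 ≡ 0 → (∀ {a} → 2 + c ≤ a → a < n → f a ≡ 0) →
                 Σ< n (f ∘ suc) ≡ f n + Σ< c (f ∘ (2 +_))
Σ<-suc-top+low {c} {suc (suc m)} f (s≤s (s≤s c≤m)) f1 f0 = begin
  Σ< (2 + m) (f ∘ suc)                  ≡⟨ Σ<-snoc (suc m) (f ∘ suc) ⟩
  (f 1 + Σ< m (f ∘ (2 +_))) + f (2 + m) ≡⟨ cong (λ s → (f 1 + s) + f (2 + m)) (Σ<-truncate c≤m
                                             λ c≤i i<m → f0 (s≤s (s≤s c≤i)) (s≤s (s≤s i<m))) ⟩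
  (f 1 + Σ< c (f ∘ (2 +_))) + f (2 + m) ≡⟨ cong (λ z → (z + Σ< c (f ∘ (2 +_))) + f (2 + m)) f1 ⟩
  Σ< c (f ∘ (2 +_)) + f (2 + m)         ≡⟨ +-comm _ (f (2 + m)) ⟩
  f (2 + m) + Σ< c (f ∘ (2 +_))         ∎

-- Orderings of r distinct numbers in which every entry is the least or the greatest of itself
-- and the entries after it.
peelings : ℕ → ℕ
peelings zero    = 1
peelings (suc r) = 2 ^ r

-- Completions of a decreasing prefix when its next entry may be any of 2, …, c + 1, or n, and r of
-- the values 2, …, n - 1 are still unplaced.
prefixCount : ℕ → ℕ → ℕ
prefixCount c zero    = 1
prefixCount c (suc r) = peelings (suc r) + Σ< c (λ c′ → prefixCount c′ r)

prefixCount-pascal : ∀ c r → prefixCount (suc c) (suc r) ≡ prefixCount c (suc r) + prefixCount c r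
prefixCount-pascal c r = trans (cong (2 ^ r +_) (Σ<-snoc c _)) (sym (+-assoc (2 ^ r) _ _))

prefixCount-offDiagonal : ∀ c d → prefixCount c (c + suc d) ≡ 3 ^ c * 2 ^ d
prefixCount-offDiagonal zero    d = refl
prefixCount-offDiagonal (suc c) d = begin
  prefixCount (suc c) (suc (c + suc d))                       ≡⟨ prefixCount-pascal c (c + suc d) ⟩
  prefixCount c (suc (c + suc d)) + prefixCount c (c + suc d) ≡⟨ cong₂ _+_
    (trans (cong (prefixCount c) (sym (+-suc c (suc d)))) (prefixCount-offDiagonal c (suc d)))
    (prefixCount-offDiagonal c d) ⟩
  3 ^ c * (2 * 2 ^ d) + 3 ^ c * 2 ^ d                         ≡⟨ regroup (3 ^ c) (2 ^ d) ⟩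
  3 * 3 ^ c * 2 ^ d                                           ∎
  where
  regroup : ∀ x y → x * (2 * y) + x * y ≡ 3 * x * y
  regroup = solve-∀

2*prefixCount-diagonal : ∀ c → 2 * prefixCount c c ≡ 3 ^ c + 1
2*prefixCount-diagonal zero    = refl
2*prefixCount-diagonal (suc c) = begin
  2 * prefixCount (suc c) (suc c)                   ≡⟨ cong (2 *_) (prefixCount-pascal c c) ⟩
  2 * (prefixCount c (suc c) + prefixCount c c)     ≡⟨ *-distribˡ-+ 2 (prefixCount c (suc c)) _ ⟩
  2 * prefixCount c (suc c) + 2 * prefixCount c c   ≡⟨ cong₂ _+_
    (cong (2 *_) (trans (cong (prefixCount c) (+-comm 1 c)) (prefixCount-offDiagonal c 0)))
    (2*prefixCount-diagonal c) ⟩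
  2 * (3 ^ c * 1) + (3 ^ c + 1)                     ≡⟨ regroup (3 ^ c) ⟩
  3 * 3 ^ c + 1                                     ∎
  where
  regroup : ∀ x → 2 * (x * 1) + (x + 1) ≡ 3 * x + 1
  regroup = solve-∀

prefixCount-diagonal : ∀ k → prefixCount k k ≡ (1 + 3 ^ k) / 2
prefixCount-diagonal k = sym (begin
  (1 + 3 ^ k) / 2         ≡⟨ cong (_/ 2) (trans (+-comm 1 (3 ^ k))
                               (trans (sym (2*prefixCount-diagonal k)) (*-comm 2 (prefixCount k k)))) ⟩
  prefixCount k k * 2 / 2 ≡⟨ m*n/n≡m (prefixCount k k) 2 ⟩
  prefixCount k k         ∎)

-- Counting words letter by letter

count : {A : Set} → (A → Bool) → List A → ℕ
count p []       = 0
count p (x ∷ xs) = if p x then suc (count p xs) else count p xs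

module _ {A : Set} where

  length-filterᵇ-filter : ∀ {P : A → Set} (P? : Decidable P) (p : A → Bool) xs →
                          length (filterᵇ p (filter P? xs)) ≡ count (λ x → does (P? x) ∧ p x) xs
  length-filterᵇ-filter P? p []       = refl
  length-filterᵇ-filter P? p (x ∷ xs) with does (P? x)
  ... | false = length-filterᵇ-filter P? p xs
  ... | true  with p x
  ...   | true  = cong suc (length-filterᵇ-filter P? p xs)
  ...   | false = length-filterᵇ-filter P? p xs

  count-++ : ∀ p (xs ys : List A) → count p (xs ++ ys) ≡ count p xs + count p ys
  count-++ p []       ys = refl
  count-++ p (x ∷ xs) ys with p x
  ... | true  = cong suc (count-++ p xs ys)
  ... | false = count-++ p xs ys

  count-map : {B : Set} (p : A → Bool) (f : B → A) (xs : List B) → count p (map f xs) ≡ count (p ∘ f) xs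
  count-map p f []       = refl
  count-map p f (x ∷ xs) = cong (λ c → if p (f x) then suc c else c) (count-map p f xs)

  count-cong-∈ : ∀ {p q : A → Bool} xs → (∀ {x} → x ∈ xs → p x ≡ q x) → count p xs ≡ count q xs
  count-cong-∈ []       _   = refl
  count-cong-∈ (x ∷ xs) p≗q =
    cong₂ (λ b c → if b then suc c else c) (p≗q (here refl)) (count-cong-∈ xs (p≗q ∘ there))

  count-none : ∀ {p : A → Bool} xs → (∀ {x} → x ∈ xs → ¬ T (p x)) → count p xs ≡ 0
  count-none {p} []       _  = refl
  count-none {p} (x ∷ xs) ¬p with p x | ¬p (here refl)
  ... | true  | ¬px = ⊥-elim (¬px _)
  ... | false | _   = count-none xs (¬p ∘ there)

  count-concatMap-applyUpTo : {B : Set} (p : A → Bool) (g : B → List A) (f : ℕ → B) (m : ℕ) →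
    count p (concatMap g (applyUpTo f m)) ≡ Σ< m (λ i → count p (g (f i)))
  count-concatMap-applyUpTo p g f zero    = refl
  count-concatMap-applyUpTo p g f (suc m) = trans (count-++ p (g (f 0)) _)
    (cong (count p (g (f 0)) +_) (count-concatMap-applyUpTo p g (f ∘ suc) m))

∈-words⁻ : ∀ k n {w} → w ∈ words k n → length w ≡ k × All (InRange n) w
∈-words⁻ zero    n (here refl) = refl , []
∈-words⁻ (suc k) n w∈
  with a , a∈ , w∈′ ← find (∈-concatMap⁻ (λ a → map (a ∷_) (words k n)) {xs = map suc (upTo n)} w∈)
  with ws , ws∈ , refl ← map∷⁻ w∈′
  with i , i∈ , refl ← ∈-map⁻ suc a∈
  = Product.map (cong suc) ((s≤s z≤n , ∈-upTo⁻ i∈) ∷_) (∈-words⁻ k n ws∈)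

count-words-suc : ∀ (p : List ℕ → Bool) k n →
                  count p (words (suc k) n) ≡ Σ< n (λ i → count (p ∘ (suc i ∷_)) (words k n))
count-words-suc p k n = begin
  count p (concatMap (λ a → map (a ∷_) (words k n)) (map suc (upTo n)))
    ≡⟨ cong (count p ∘ concatMap (λ a → map (a ∷_) (words k n))) (map-upTo suc n) ⟩
  count p (concatMap (λ a → map (a ∷_) (words k n)) (applyUpTo suc n))
    ≡⟨ count-concatMap-applyUpTo p _ suc n ⟩
  Σ< n (λ i → count p (map (suc i ∷_) (words k n)))
    ≡⟨ Σ<-cong n (λ {i} _ → count-map p (suc i ∷_) (words k n)) ⟩
  Σ< n (λ i → count (p ∘ (suc i ∷_)) (words k n)) ∎

-- The pattern MMP(1,0,1,1) and the factor n 1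

¬T⇒≡false : ∀ {b} → ¬ T b → b ≡ false
¬T⇒≡false {false} _  = refl
¬T⇒≡false {true}  ¬t = ⊥-elim (¬t _)

matchesMMP⁺ : ∀ pre x suf → Any (x <_) suf → Any (_< x) pre → Any (_< x) suf → T (matchesMMP pre x suf)
matchesMMP⁺ pre x suf larger smaller smallerAfter =
  from T-∧ (any⁺ _ (Any.map <⇒<ᵇ larger) ,
            from T-∧ (any⁺ _ (Any.map <⇒<ᵇ smaller) , any⁺ _ (Any.map <⇒<ᵇ smallerAfter)))

matchesMMP⁻ : ∀ pre x suf → T (matchesMMP pre x suf) → Any (x <_) suf × Any (_< x) pre × Any (_< x) suf
matchesMMP⁻ pre x suf m =
  let (larger , m′) = to T-∧ m ; (smaller , smallerAfter) = to T-∧ m′ in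
  Any.map (<ᵇ⇒< _ _) (any⁻ _ suf larger) , Any.map (<ᵇ⇒< _ _) (any⁻ _ pre smaller) ,
  Any.map (<ᵇ⇒< _ _) (any⁻ _ suf smallerAfter)

noLargerAfter⇒¬matchesMMP : ∀ pre {x} suf → All (_≤ x) suf → ¬ T (matchesMMP pre x suf)
noLargerAfter⇒¬matchesMMP pre suf ≤x m =
  All¬⇒¬Any (All.map ≤⇒≯ ≤x) (proj₁ (matchesMMP⁻ pre _ suf m))

noSmallerBefore⇒¬matchesMMP : ∀ pre {x} suf → All (x ≤_) pre → ¬ T (matchesMMP pre x suf)
noSmallerBefore⇒¬matchesMMP pre suf x≤ m =
  All¬⇒¬Any (All.map ≤⇒≯ x≤) (proj₁ (proj₂ (matchesMMP⁻ pre _ suf m)))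

noSmallerAfter⇒¬matchesMMP : ∀ pre {x} suf → All (x ≤_) suf → ¬ T (matchesMMP pre x suf)
noSmallerAfter⇒¬matchesMMP pre suf x≤ m =
  All¬⇒¬Any (All.map ≤⇒≯ x≤) (proj₂ (proj₂ (matchesMMP⁻ pre _ suf m)))

mmpAux-unmatched : ∀ pre x xs → ¬ T (matchesMMP pre x xs) → mmpAux pre (x ∷ xs) ≡ mmpAux (pre ++ [ x ]) xs
mmpAux-unmatched pre x xs ¬m with matchesMMP pre x xs
... | false = refl
... | true  = ⊥-elim (¬m _)

mmpAux-matched : ∀ pre x xs → T (matchesMMP pre x xs) → mmpAux pre (x ∷ xs) ≢ 0
mmpAux-matched pre x xs m with matchesMMP pre x xs
... | true  = λ ()
... | false = λ _ → m

module _ {n : ℕ} where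

  nThen1-∷⁻ : ∀ x y ys → T (nThen1 n (x ∷ y ∷ ys)) → (x ≡ n × y ≡ 1) ⊎ T (nThen1 n (y ∷ ys))
  nThen1-∷⁻ x y ys t =
    Sum.map₁ (λ t′ → let (p , q) = to T-∧ t′ in ≡ᵇ⇒≡ x n p , ≡ᵇ⇒≡ y 1 q) (to T-∨ t)

  nThen1-∷⁺ : ∀ x y ys → (x ≡ n × y ≡ 1) ⊎ T (nThen1 n (y ∷ ys)) → T (nThen1 n (x ∷ y ∷ ys))
  nThen1-∷⁺ x y ys = from T-∨ ∘ Sum.map₁ λ (p , q) → from T-∧ (≡⇒≡ᵇ x n p , ≡⇒≡ᵇ y 1 q)

  nThen1-tail : ∀ x ys → x ≢ n → T (nThen1 n (x ∷ ys)) → T (nThen1 n ys)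
  nThen1-tail x (y ∷ ys) x≢n t = Sum.[ (λ (x≡n , _) → ⊥-elim (x≢n x≡n)) , id ] (nThen1-∷⁻ x y ys t)

  nThen1⇒∈ : ∀ xs → T (nThen1 n xs) → n ∈ xs × 1 ∈ xs
  nThen1⇒∈ (x ∷ ys@(y ∷ zs)) t = Sum.[
    (λ (x≡n , y≡1) → here (sym x≡n) , there (here (sym y≡1))) ,
    Product.map there there ∘ nThen1⇒∈ ys ] (nThen1-∷⁻ x y zs t)

  nThen1-++ˡ : ∀ xs ys → T (nThen1 n xs) → T (nThen1 n (xs ++ ys))
  nThen1-++ˡ (x ∷ y ∷ xs) ys t =
    nThen1-∷⁺ x y (xs ++ ys) (Sum.map₂ (nThen1-++ˡ (y ∷ xs) ys) (nThen1-∷⁻ x y xs t))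

  nThen1-++ʳ : ∀ xs ys → T (nThen1 n ys) → T (nThen1 n (xs ++ ys))
  nThen1-++ʳ []       ys t = t
  nThen1-++ʳ (x ∷ xs) ys t = prepend (xs ++ ys) (nThen1-++ʳ xs ys t)
    where
    prepend : ∀ zs → T (nThen1 n zs) → T (nThen1 n (x ∷ zs))
    prepend (z ∷ z′ ∷ zs) t = nThen1-∷⁺ x z (z′ ∷ zs) (inj₂ t)

  nThen1-++⁻ : ∀ xs ys → n ∉ xs → T (nThen1 n (xs ++ ys)) → T (nThen1 n ys)
  nThen1-++⁻ []       ys _   t = t
  nThen1-++⁻ (x ∷ xs) ys n∉ t =
    nThen1-++⁻ xs ys (n∉ ∘ there) (nThen1-tail x (xs ++ ys) (λ x≡n → n∉ (here (sym x≡n))) t)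

-- Only the positions inside w are tested for MMP(1,0,1,1); pre serves as their left context.
valid : ℕ → List ℕ → List ℕ → Bool
valid n pre w = does (unique? (pre ++ w)) ∧ nThen1 n (pre ++ w) ∧ (mmpAux pre w ≡ᵇ 0)

count18≡count-valid : ∀ n → count18 n ≡ count (valid n []) (words n n)
count18≡count-valid n = length-filterᵇ-filter unique? _ (words n n)

module _ {n : ℕ} where

  valid⁻ : ∀ pre w → T (valid n pre w) → Unique (pre ++ w) × T (nThen1 n (pre ++ w)) × mmpAux pre w ≡ 0
  valid⁻ pre w t =
    let (u , t′) = to (T-∧ {does (unique? (pre ++ w))}) t ; (n1 , z) = to (T-∧ {nThen1 n (pre ++ w)}) t′ in
    toWitness (subst T (sym (isYes≗does (unique? (pre ++ w)))) u) , n1 , ≡ᵇ⇒≡ _ 0 z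

  valid-[] : ∀ pre → Unique pre → T (nThen1 n pre) → valid n pre [] ≡ true
  valid-[] pre u n1 rewrite ++-identityʳ pre with unique? pre
  ... | yes _ = trans (∧-identityʳ _) (to T-≡ n1)
  ... | no ¬u = ⊥-elim (¬u u)

  valid-∷ : ∀ pre a w → (T (valid n (pre ++ [ a ]) w) → ¬ T (matchesMMP pre a w)) →
            valid n pre (a ∷ w) ≡ valid n (pre ++ [ a ]) w
  valid-∷ pre a w unmatched with T? (matchesMMP pre a w)
  ... | no ¬m = cong₂ (λ xs k → does (unique? xs) ∧ nThen1 n xs ∧ (k ≡ᵇ 0))
                      (sym (++-assoc pre [ a ] w)) (mmpAux-unmatched pre a w ¬m)
  ... | yes m = trans (¬T⇒≡false λ t → mmpAux-matched pre a w m (proj₂ (proj₂ (valid⁻ pre (a ∷ w) t))))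
                      (sym (¬T⇒≡false λ t → unmatched t m))

-- Building the permutations from the left

record Remaining (P : ℕ → Set) (used rest : List ℕ) (r : ℕ) : Set where
  field
    sorted   : AllPairs _<_ rest
    size     : length rest ≡ r
    bounded  : All P rest
    complete : ∀ {x} → P x → x ∉ used → x ∈ rest
    fresh    : ∀ {x} → x ∈ rest → x ∉ used
    distinct : Unique used

  unique-rest : Unique rest
  unique-rest = AllPairs.map <⇒≢ sorted

  ∉rest⇒∈used : ∀ {x} → P x → x ∉ rest → x ∈ used
  ∉rest⇒∈used {x} px x∉rest with x ∈? used
  ... | yes x∈used = x∈used
  ... | no  x∉used = ⊥-elim (x∉rest (complete px x∉used))

  suffix⊆without : ∀ {a w} → Unique (used ++ a ∷ w) → All P w → w ⊆ without a rest
  suffix⊆without {a} {w} u pw {y} y∈w = ∈-without⁺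
    (complete (All.lookup pw y∈w) λ y∈used → Unique-++⇒disjoint used u y∈used (there y∈w))
    (λ y≡a → Unique[x∷xs]⇒x∉xs (Unique-++⁻ʳ used u) (subst (_∈ w) y≡a y∈w))

remaining-∷ʳ : ∀ {P used rest r a} → Remaining P used rest (suc r) → a ∈ rest →
               Remaining P (used ++ [ a ]) (without a rest) r
remaining-∷ʳ {used = used} {rest} {a = a} R a∈rest = record
  { sorted   = AllPairs.filter⁺ _ sorted
  ; size     = suc-injective (trans (length-without unique-rest a∈rest) size)
  ; bounded  = All.filter⁺ _ bounded
  ; complete = λ px x∉ → ∈-without⁺ (complete px (x∉ ∘ ∈-++⁺ˡ)) (x∉ ∘ ∈-++⁺ʳ used ∘ here)
  ; fresh    = λ x∈ x∈used++a → let (x∈rest , x≢a) = ∈-without⁻ rest x∈ in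
      Sum.[ fresh x∈rest , (λ { (here x≡a) → x≢a x≡a }) ] (∈-++⁻ used x∈used++a)
  ; distinct = Unique-∷ʳ distinct (fresh a∈rest)
  }
  where open Remaining R

module Peeling (n : ℕ) where

  record PeelState (pre C : List ℕ) (r : ℕ) : Set where
    field
      remaining : Remaining (InRange n) pre C r
      one∈pre   : 1 ∈ pre
      n1-pre    : T (nThen1 n pre)
    open Remaining remaining public

  peelState-∷ʳ : ∀ {pre C r a} → PeelState pre C (suc r) → a ∈ C → PeelState (pre ++ [ a ]) (without a C) r
  peelState-∷ʳ {pre} {a = a} S a∈C = record
    { remaining = remaining-∷ʳ remaining a∈C
    ; one∈pre   = ∈-++⁺ˡ one∈pre
    ; n1-pre    = nThen1-++ˡ pre [ a ] n1-pre
    }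
    where open PeelState S

  module PeelStep {pre C r} (S : PeelState pre C (suc r))
                  (IH : ∀ {pre′ C′} → PeelState pre′ C′ r → count (valid n pre′) (words r n) ≡ peelings r) where
    open PeelState S

    startingWith : ℕ → ℕ
    startingWith a = count (valid n pre ∘ (a ∷_)) (words r n)

    startingWith-absent : ∀ {a} → InRange n a → a ∉ C → startingWith a ≡ 0
    startingWith-absent ra a∉C = count-none (words r n) λ {w} _ t →
      Unique-++⇒disjoint pre (proj₁ (valid⁻ pre (_ ∷ w) t)) (∉rest⇒∈used ra a∉C) (here refl)

    startingWith-extremal : ∀ {a} → a ∈ C → All (a ≤_) C ⊎ All (_≤ a) C → startingWith a ≡ peelings r
    startingWith-extremal {a} a∈C extremal = begin
      startingWith a
        ≡⟨ count-cong-∈ (words r n) (λ w∈ → valid-∷ pre a _ (unmatched w∈)) ⟩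
      count (valid n (pre ++ [ a ])) (words r n)
        ≡⟨ IH (peelState-∷ʳ S a∈C) ⟩
      peelings r ∎
      where
      unmatched : ∀ {w} → w ∈ words r n → T (valid n (pre ++ [ a ]) w) → ¬ T (matchesMMP pre a w)
      unmatched {w} w∈ t = Sum.[ noSmallerAfter⇒¬matchesMMP pre w ∘ anti-mono w⊆C
                               , noLargerAfter⇒¬matchesMMP pre w ∘ anti-mono w⊆C ] extremal
        where
        u : Unique (pre ++ a ∷ w)
        u = subst Unique (++-assoc pre [ a ] w) (proj₁ (valid⁻ (pre ++ [ a ]) w t))
        w⊆C : w ⊆ C
        w⊆C = proj₁ ∘ ∈-without⁻ C ∘ suffix⊆without u (proj₂ (∈-words⁻ r n w∈))

    -- The pigeonhole principle puts lo and hi after a, and 1 occurs before a.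
    startingWith-interior : ∀ {lo a hi} → lo ∈ C → a ∈ C → hi ∈ C → lo < a → a < hi → startingWith a ≡ 0
    startingWith-interior {lo} {a} {hi} lo∈C a∈C hi∈C lo<a a<hi = count-none (words r n) λ {w} w∈ t →
      let (u , _ , mmp≡0) = valid⁻ pre (a ∷ w) t
          (|w|≡r , w-range) = ∈-words⁻ r n w∈
          C∖a⊆w = pigeonhole (Unique-++⁻ʳ [ a ] (Unique-++⁻ʳ pre u)) (suffix⊆without u w-range)
                    (≤-reflexive (trans (suc-injective (trans (length-without unique-rest a∈C) size)) (sym |w|≡r)))
      in mmpAux-matched pre a w
           (matchesMMP⁺ pre a w (lose (C∖a⊆w (∈-without⁺ hi∈C (>⇒≢ a<hi))) a<hi)
                                (lose one∈pre (≤-<-trans (proj₁ (All.lookup bounded lo∈C)) lo<a))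
                                (lose (C∖a⊆w (∈-without⁺ lo∈C (<⇒≢ lo<a))) lo<a))
           mmp≡0

    startingWith-nonExtremal : ∀ {lo hi a} → lo ∈ C → hi ∈ C → All (lo ≤_) C → All (_≤ hi) C →
                               InRange n a → a ≢ lo → a ≢ hi → startingWith a ≡ 0
    startingWith-nonExtremal {a = a} lo∈C hi∈C lo≤C C≤hi ra a≢lo a≢hi with a ∈? C
    ... | no  a∉C = startingWith-absent ra a∉C
    ... | yes a∈C = startingWith-interior lo∈C a∈C hi∈C
                      (≤∧≢⇒< (All.lookup lo≤C a∈C) (≢-sym a≢lo)) (≤∧≢⇒< (All.lookup C≤hi a∈C) a≢hi)

  peel-count : ∀ r {pre C} → PeelState pre C r → count (valid n pre) (words r n) ≡ peelings r
  peel-count zero {pre} S = cong (λ b → if b then 1 else 0) (valid-[] pre distinct n1-pre)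
    where open PeelState S
  peel-count (suc r) {C = []} S = ⊥-elim (0≢1+n (PeelState.size S))
  peel-count (suc (suc r)) {C = _ ∷ []} S = ⊥-elim (0≢1+n (suc-injective (PeelState.size S)))
  peel-count (suc zero) {C = _ ∷ _ ∷ _} S = ⊥-elim (0≢1+n (sym (suc-injective (PeelState.size S))))
  peel-count (suc zero) {pre} {h ∷ []} S = begin
    count (valid n pre) (words 1 n)
      ≡⟨ count-words-suc (valid n pre) 0 n ⟩
    Σ< n (startingWith ∘ suc)
      ≡⟨ Σ<-suc-single startingWith (All.lookup bounded (here refl))
           (λ ra a≢h → startingWith-absent ra λ { (here a≡h) → a≢h a≡h }) ⟩
    startingWith h
      ≡⟨ startingWith-extremal (here refl) (inj₁ (≤-refl ∷ [])) ⟩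
    1 ∎
    where
    open PeelState S
    open PeelStep S (peel-count zero)
  peel-count (suc (suc r)) {pre} {C@(h ∷ y ∷ t)} S = begin
    count (valid n pre) (words (2 + r) n)
      ≡⟨ count-words-suc (valid n pre) (suc r) n ⟩
    Σ< n (startingWith ∘ suc)
      ≡⟨ Σ<-suc-pair startingWith (All.lookup bounded (here refl)) (All.lookup bounded hi∈C) h<hi
           (startingWith-nonExtremal (here refl) hi∈C h≤C C≤hi) ⟩
    startingWith h + startingWith hi
      ≡⟨ cong₂ _+_ (startingWith-extremal (here refl) (inj₁ h≤C))
                   (startingWith-extremal hi∈C (inj₂ C≤hi)) ⟩
    2 ^ r + 2 ^ r
      ≡⟨ cong (2 ^ r +_) (sym (+-identityʳ (2 ^ r))) ⟩
    peelings (2 + r) ∎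
    where
    open PeelState S
    open PeelStep S (peel-count (suc r))
    hi : ℕ
    hi = max h (y ∷ t)
    hi∈C : hi ∈ C
    hi∈C = Sum.[ here , there ]′ (argmax-sel id h (y ∷ t))
    C≤hi : All (_≤ hi) C
    C≤hi = ⊥≤max h (y ∷ t) ∷ xs≤max h (y ∷ t)
    h<t : All (h <_) (y ∷ t)
    h<t = AllPairs.head sorted
    h≤C : All (h ≤_) C
    h≤C = ≤-refl ∷ All.map <⇒≤ h<t
    h<hi : h < hi
    h<hi = <-≤-trans (All.lookup h<t (here refl)) (All.lookup C≤hi (there (here refl)))

module Prefix (n : ℕ) where
  open Peeling n using (PeelState; peel-count)

  Middle : ℕ → Set
  Middle x = 2 ≤ x × x < n

  record PrefixState (pre D : List ℕ) (c r : ℕ) : Set where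
    field
      remaining : Remaining Middle pre D r
      bound     : 2 + c ≤ n
      pre-range : All (λ y → 2 + c ≤ y × y < n) pre
      covered   : ∀ {x} → 2 + c ≤ x → x < n → Any (_≤ x) pre
      low⊆D     : ∀ {x} → 2 ≤ x → x < 2 + c → x ∈ D
    open Remaining remaining public

  prefixState-∷ʳ : ∀ {pre D c c′ r} → PrefixState pre D c (suc r) → c′ < c →
                   PrefixState (pre ++ [ 2 + c′ ]) (without (2 + c′) D) c′ r
  prefixState-∷ʳ {pre} {D} {c} {c′} S c′<c = record
    { remaining = remaining-∷ʳ remaining a∈D
    ; bound     = ≤-trans (<⇒≤ a<2+c) bound
    ; pre-range = All.++⁺ (All.map (Product.map₁ (≤-trans (<⇒≤ a<2+c))) pre-range)
                          ((≤-refl , <-≤-trans a<2+c bound) ∷ [])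
    ; covered   = λ a≤x _ → lose (∈-++⁺ʳ pre (here refl)) a≤x
    ; low⊆D     = λ 2≤x x<a → ∈-without⁺ (low⊆D 2≤x (<-trans x<a a<2+c)) (<⇒≢ x<a)
    }
    where
    open PrefixState S
    a<2+c : 2 + c′ < 2 + c
    a<2+c = s≤s (s≤s c′<c)
    a∈D : 2 + c′ ∈ D
    a∈D = low⊆D (s≤s (s≤s z≤n)) a<2+c

  module PrefixStep {pre D c r} (S : PrefixState pre D c r) where
    open PrefixState S

    startingWith : ℕ → ℕ
    startingWith a = count (valid n pre ∘ (a ∷_)) (words (suc r) n)

    1<n : 1 < n
    1<n = ≤-trans (s≤s (s≤s z≤n)) bound

    n∉pre : n ∉ pre
    n∉pre n∈pre = <-irrefl refl (proj₂ (All.lookup pre-range n∈pre))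

    n-and-1-after : ∀ {a w} → a ≢ n → T (nThen1 n (pre ++ a ∷ w)) → n ∈ w × 1 ∈ w
    n-and-1-after {a} {w} a≢n n1 = nThen1⇒∈ w (nThen1-++⁻ (pre ++ [ a ]) w n∉pre++a
      (subst (T ∘ nThen1 n) (sym (++-assoc pre [ a ] w)) n1))
      where
      n∉pre++a : n ∉ pre ++ [ a ]
      n∉pre++a n∈ = Sum.[ n∉pre , (λ { (here n≡a) → a≢n (sym n≡a) }) ] (∈-++⁻ pre n∈)

    startingWith-1 : startingWith 1 ≡ 0
    startingWith-1 = count-none (words (suc r) n) λ {w} _ t →
      let (u , n1 , _) = valid⁻ pre (1 ∷ w) t in
      Unique[x∷xs]⇒x∉xs (Unique-++⁻ʳ pre u) (proj₂ (n-and-1-after (<⇒≢ 1<n) n1))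

    startingWith-high : ∀ {a} → 2 + c ≤ a → a < n → startingWith a ≡ 0
    startingWith-high {a} 2+c≤a a<n =
      count-none (words (suc r) n) λ {w} _ t → refute w (valid⁻ pre (a ∷ w) t)
      where
      refute : ∀ w → Unique (pre ++ a ∷ w) × T (nThen1 n (pre ++ a ∷ w)) × mmpAux pre (a ∷ w) ≡ 0 → ⊥
      refute w (u , n1 , mmp≡0)
        with y , y∈pre , y≤a ← find (covered 2+c≤a a<n)
        with n∈w , 1∈w ← n-and-1-after (<⇒≢ a<n) n1
        with m≤n⇒m<n∨m≡n y≤a
      ... | inj₂ refl = Unique-++⇒disjoint pre u y∈pre (here refl)
      ... | inj₁ y<a  = mmpAux-matched pre a w
            (matchesMMP⁺ pre a w (lose n∈w a<n) (lose y∈pre y<a)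
                                 (lose 1∈w (<-≤-trans (s≤s (s≤s z≤n)) 2+c≤a)))
            mmp≡0

    peelState-after-n1 : PeelState ((pre ++ [ n ]) ++ [ 1 ]) D r
    peelState-after-n1 = record
      { remaining = record
        { sorted   = sorted
        ; size     = size
        ; bounded  = All.map (Product.map <⇒≤ <⇒≤) bounded
        ; complete = λ (1≤x , x≤n) x∉ → complete
            (≤∧≢⇒< 1≤x (x∉ ∘ ∈-++⁺ʳ _ ∘ here ∘ sym) , ≤∧≢⇒< x≤n (x∉ ∘ ∈-++⁺ˡ ∘ ∈-++⁺ʳ pre ∘ here))
            (x∉ ∘ ∈-++⁺ˡ ∘ ∈-++⁺ˡ)
        ; fresh    = λ x∈D x∈ → let (2≤x , x<n) = All.lookup bounded x∈D in
            Sum.[ Sum.[ fresh x∈D , (λ { (here x≡n) → <-irrefl x≡n x<n }) ] ∘ ∈-++⁻ pre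
                , (λ { (here x≡1) → <-irrefl (sym x≡1) 2≤x }) ] (∈-++⁻ (pre ++ [ n ]) x∈)
        ; distinct = Unique-∷ʳ (Unique-∷ʳ distinct n∉pre)
            (Sum.[ (λ 1∈pre → 1+n≰n (≤-trans (s≤s (s≤s z≤n)) (proj₁ (All.lookup pre-range 1∈pre))))
                 , (λ { (here 1≡n) → <-irrefl 1≡n 1<n }) ] ∘ ∈-++⁻ pre)
        }
      ; one∈pre = ∈-++⁺ʳ _ (here refl)
      ; n1-pre  = subst (T ∘ nThen1 n) (sym (++-assoc pre [ n ] [ 1 ]))
                    (nThen1-++ʳ pre (n ∷ 1 ∷ []) (nThen1-∷⁺ n 1 [] (inj₁ (refl , refl))))
      }

    startingWith-n : startingWith n ≡ peelings r
    startingWith-n = begin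
      startingWith n                                        ≡⟨ count-words-suc (valid n pre ∘ (n ∷_)) r n ⟩
      Σ< n (afterN ∘ suc)                                   ≡⟨ Σ<-suc-single afterN (s≤s z≤n , <⇒≤ 1<n) afterN-≢1 ⟩
      afterN 1                                              ≡⟨ count-cong-∈ (words r n) after-n1 ⟩
      count (valid n ((pre ++ [ n ]) ++ [ 1 ])) (words r n) ≡⟨ peel-count r peelState-after-n1 ⟩
      peelings r                                            ∎
      where
      afterN : ℕ → ℕ
      afterN b = count (λ w → valid n pre (n ∷ b ∷ w)) (words r n)
      afterN-≢1 : ∀ {b} → InRange n b → b ≢ 1 → afterN b ≡ 0
      afterN-≢1 {b} _ b≢1 = count-none (words r n) λ {w} _ t →
        let (u , n1 , _) = valid⁻ pre (n ∷ b ∷ w) t in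
        Sum.[ (λ (_ , b≡1) → b≢1 b≡1)
            , (λ n1′ → Unique[x∷xs]⇒x∉xs (Unique-++⁻ʳ pre u) (proj₁ (nThen1⇒∈ (b ∷ w) n1′))) ]
          (nThen1-∷⁻ n b w (nThen1-++⁻ pre (n ∷ b ∷ w) n∉pre n1))
      after-n1 : ∀ {w} → w ∈ words r n → valid n pre (n ∷ 1 ∷ w) ≡ valid n ((pre ++ [ n ]) ++ [ 1 ]) w
      after-n1 {w} w∈ = trans
        (valid-∷ pre n (1 ∷ w) λ _ →
          noLargerAfter⇒¬matchesMMP pre (1 ∷ w) (<⇒≤ 1<n ∷ All.map proj₂ w-range))
        (valid-∷ (pre ++ [ n ]) 1 w λ _ →
          noSmallerAfter⇒¬matchesMMP (pre ++ [ n ]) w (All.map proj₁ w-range))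
        where w-range = proj₂ (∈-words⁻ r n w∈)

    count-by-first-letter : count (valid n pre) (words (2 + r) n) ≡ startingWith n + Σ< c (startingWith ∘ (2 +_))
    count-by-first-letter = trans (count-words-suc (valid n pre) (suc r) n)
                                  (Σ<-suc-top+low startingWith bound startingWith-1 startingWith-high)

  module PrefixLowStep {pre D c r} (S : PrefixState pre D c (suc r))
                       (IH : ∀ {pre′ D′ c′} → PrefixState pre′ D′ c′ r →
                             count (valid n pre′) (words (2 + r) n) ≡ prefixCount c′ r) where
    open PrefixState S
    open PrefixStep S using (startingWith)

    startingWith-low : ∀ {c′} → c′ < c → startingWith (2 + c′) ≡ prefixCount c′ r
    startingWith-low {c′} c′<c = begin
      startingWith (2 + c′)
        ≡⟨ count-cong-∈ (words (2 + r) n) (λ {w} _ → valid-∷ pre (2 + c′) w λ _ →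
             noSmallerBefore⇒¬matchesMMP pre w
               (All.map (≤-trans (<⇒≤ (s≤s (s≤s c′<c))) ∘ proj₁) pre-range)) ⟩
      count (valid n (pre ++ [ 2 + c′ ])) (words (2 + r) n)
        ≡⟨ IH (prefixState-∷ʳ S c′<c) ⟩
      prefixCount c′ r ∎

  prefix-count : ∀ r {pre D c} → PrefixState pre D c r → count (valid n pre) (words (2 + r) n) ≡ prefixCount c r
  prefix-count zero {pre} {D} {c} S = begin
    count (valid n pre) (words 2 n)
      ≡⟨ count-by-first-letter ⟩
    startingWith n + Σ< c (startingWith ∘ (2 +_))
      ≡⟨ cong₂ _+_ startingWith-n (Σ<-zero c λ c′<c →
           ⊥-elim (<-irrefl (sym size) (∈-length (low⊆D (s≤s (s≤s z≤n)) (s≤s (s≤s c′<c)))))) ⟩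
    1 ∎
    where
    open PrefixState S
    open PrefixStep S
  prefix-count (suc r) {pre} {D} {c} S = begin
    count (valid n pre) (words (3 + r) n)            ≡⟨ count-by-first-letter ⟩
    startingWith n + Σ< c (startingWith ∘ (2 +_))    ≡⟨ cong (startingWith n +_) (Σ<-cong c startingWith-low) ⟩
    startingWith n + Σ< c (λ c′ → prefixCount c′ r) ≡⟨ cong (_+ _) startingWith-n ⟩
    prefixCount c (suc r)                            ∎
    where
    open PrefixStep S
    open PrefixLowStep S (prefix-count r)

initialState : ∀ k → Prefix.PrefixState (2 + k) [] (applyUpTo (2 +_) k) k k
initialState k = record
  { remaining = record
    { sorted   = AllPairs.applyUpTo⁺₁ (2 +_) k λ i<j _ → s≤s (s≤s i<j)
    ; size     = length-applyUpTo (2 +_) k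
    ; bounded  = All.applyUpTo⁺₁ (2 +_) k λ i<k → s≤s (s≤s z≤n) , s≤s (s≤s i<k)
    ; complete = λ (2≤x , x<n) _ → middle∈ 2≤x x<n
    ; fresh    = λ _ ()
    ; distinct = []
    }
  ; bound     = ≤-refl
  ; pre-range = []
  ; covered   = λ 2+k≤x x<2+k → ⊥-elim (≤⇒≯ 2+k≤x x<2+k)
  ; low⊆D     = middle∈
  }
  where
  middle∈ : ∀ {x} → 2 ≤ x → x < 2 + k → x ∈ applyUpTo (2 +_) k
  middle∈ (s≤s (s≤s z≤n)) (s≤s (s≤s i<k)) = ∈-applyUpTo⁺ (2 +_) i<k

mainTheorem18 : (n : ℕ) → 2 ≤ n → count18 n ≡ (1 + 3 ^ (n ∸ 2)) / 2
mainTheorem18 (suc (suc k)) _ = begin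
  count18 (2 + k)                                  ≡⟨ count18≡count-valid (2 + k) ⟩
  count (valid (2 + k) []) (words (2 + k) (2 + k)) ≡⟨ Prefix.prefix-count (2 + k) k (initialState k) ⟩
  prefixCount k k                                  ≡⟨ prefixCount-diagonal k ⟩
  (1 + 3 ^ k) / 2                                  ∎
mainTheorem18 (suc zero) (s≤s ())
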